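{- Let $\langle A,G,H\rangle$ be a tense DRL-algebra, with $F(x)=\sim G(\sim x)$ and $P(x)=\sim H(\sim x)$. Then for all $x\in A$: (c1) $F(c)=c$ and $P(c)=c$; (c2) $G(x\vee c)=G(x)\vee c$ and $H(x\vee c)=H(x)\vee c$; (c3) $F(x\wedge c)=F(x)\wedge c$ and $P(x\wedge c)=P(x)\wedge c$.
   Context: A DRL-algebra is a structure $\langle A,\vee,\wedge,\ast,\sim,c,0,1\rangle$ such that, with $x\Rightarrow y:=\sim(x\ast(\sim y))$, $\langle A,\vee,\wedge,\ast,\Rightarrow,0,1\rangle$ is an integral commutative residuated lattice, $\sim$ is an involutive dual lattice automorphism, $\sim c=c$, and $(x\ast y)\wedge c=((x\wedge c)\ast y)\vee(x\ast(y\wedge c))$. A tense DRL-algebra is a DRL-algebra with unary $G,H$ such that, with $F(x):=\sim G(\sim x)$, $P(x):=\sim H(\sim x)$: (t0) $G(1)=H(1)=1$; (t1) $G(c)=H(c)=c$; (t2) $G(x\wedge y)=G(x)\wedge G(y)$, $H(x\wedge y)=H(x)\wedge H(y)$; (t3) $x\le GP(x)$, $x\le HF(x)$; (t4) $G(x\vee y)\le G(x)\vee F(y)$, $H(x\vee y)\le H(x)\vee P(y)$; (t5) $G(x\Rightarrow y)\le G(x)\Rightarrow G(y)$, $H(x\Rightarrow y)\le H(x)\Rightarrow H(y)$. -}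

module Defs where

open import Level using (Level; suc)
open import Relation.Binary.PropositionalEquality using (_≡_)
open import Algebra.Core using (Op₁; Op₂)
open import Algebra.Structures using (IsCommutativeMonoid)
open import Algebra.Lattice.Structures using (IsLattice)
open import Function.Bundles using (_⇔_)

record DRLAlgebra (a : Level) : Set (suc a) where
  infixr 6 _∨_
  infixr 7 _∧_
  infixr 8 _∗_
  infixr 5 _⇒_
  infix 4 _≤_
  field
    Carrier : Set a
    _∨_ _∧_ _∗_ : Op₂ Carrier
    ∼ : Op₁ Carrier
    c 𝟎 𝟏 : Carrier

  _⇒_ : Op₂ Carrier
  x ⇒ y = ∼ (x ∗ ∼ y)

  _≤_ : Carrier → Carrier → Set a
  x ≤ y = (x ∧ y) ≡ x

  field
    isLattice : IsLattice _≡_ _∨_ _∧_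
    ∗-isCommutativeMonoid : IsCommutativeMonoid _≡_ _∗_ 𝟏
    bottom : ∀ x → 𝟎 ≤ x
    top : ∀ x → x ≤ 𝟏
    residuation : ∀ x y z → (x ∗ y ≤ z) ⇔ (x ≤ y ⇒ z)
    ∼-involutive : ∀ x → ∼ (∼ x) ≡ x
    ∼-∨ : ∀ x y → ∼ (x ∨ y) ≡ ∼ x ∧ ∼ y
    ∼-∧ : ∀ x y → ∼ (x ∧ y) ≡ ∼ x ∨ ∼ y
    ∼c : ∼ c ≡ c
    ∗-∧c : ∀ x y → (x ∗ y) ∧ c ≡ ((x ∧ c) ∗ y) ∨ (x ∗ (y ∧ c))

record TenseDRLAlgebra (a : Level) : Set (suc a) where
  field
    drl : DRLAlgebra a
  open DRLAlgebra drl public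
  field
    G H : Op₁ Carrier

  F : Op₁ Carrier
  F x = ∼ (G (∼ x))

  P : Op₁ Carrier
  P x = ∼ (H (∼ x))

  field
    t0-G : G 𝟏 ≡ 𝟏
    t0-H : H 𝟏 ≡ 𝟏
    t1-G : G c ≡ c
    t1-H : H c ≡ c
    t2-G : ∀ x y → G (x ∧ y) ≡ G x ∧ G y
    t2-H : ∀ x y → H (x ∧ y) ≡ H x ∧ H y
    t3-G : ∀ x → x ≤ G (P x)
    t3-H : ∀ x → x ≤ H (F x)
    t4-G : ∀ x y → G (x ∨ y) ≤ G x ∨ F y
    t4-H : ∀ x y → H (x ∨ y) ≤ H x ∨ P y
    t5-G : ∀ x y → G (x ⇒ y) ≤ G x ⇒ G y
    t5-H : ∀ x y → H (x ⇒ y) ≤ H x ⇒ H y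

{-# OPTIONS --safe #-}
module Submission where

open import Defs
open import Level using (Level)
open import Data.Product using (_×_; _,_)
open import Relation.Binary.PropositionalEquality using (_≡_; sym; cong; subst; module ≡-Reasoning)
open import Algebra.Core using (Op₁; Op₂)
open import Algebra.Lattice.Bundles using (Lattice)
open import Algebra.Lattice.Structures using (IsLattice)
import Algebra.Lattice.Properties.Lattice as LatticeProperties
import Relation.Binary.Lattice as OrderLattice

-- Only (t1), (t2), (t4) and the fact that ∼ is a dual lattice map fixing c
-- are used, so G and H are treated alike.  F c = ∼ G c = c turns (t4) at
-- y := c into G (x ∨ c) ≤ G x ∨ c; the converse holds since G is monotone
-- and c = G c; and (c3) is the ∼-dual of (c2).
module ConstantPreservingOperator
  {a} {A : Set a} {_∨_ _∧_ : Op₂ A} (isLattice : IsLattice _≡_ _∨_ _∧_)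
  (∼ : Op₁ A)
  (∼-∨ : ∀ x y → ∼ (x ∨ y) ≡ ∼ x ∧ ∼ y)
  (∼-∧ : ∀ x y → ∼ (x ∧ y) ≡ ∼ x ∨ ∼ y)
  {c : A} (∼c : ∼ c ≡ c)
  (G : Op₁ A)
  (G-∧ : ∀ x y → G (x ∧ y) ≡ G x ∧ G y)
  (G-c : G c ≡ c)
  where

  lattice : Lattice a a
  lattice = record { isLattice = isLattice }

  open OrderLattice.Lattice (LatticeProperties.∨-∧-orderTheoreticLattice lattice)
    using (_≤_; antisym; x≤x∨y; y≤x∨y; ∨-least)
  open ≡-Reasoning

  F : Op₁ A
  F x = ∼ (G (∼ x))

  G-mono : ∀ {x y} → x ≤ y → G x ≤ G y
  G-mono {x} {y} x≡x∧y = begin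
    G x        ≡⟨ cong G x≡x∧y ⟩
    G (x ∧ y)  ≡⟨ G-∧ x y ⟩
    G x ∧ G y  ∎

  F-c : F c ≡ c
  F-c = begin
    ∼ (G (∼ c))  ≡⟨ cong (λ z → ∼ (G z)) ∼c ⟩
    ∼ (G c)      ≡⟨ cong ∼ G-c ⟩
    ∼ c          ≡⟨ ∼c ⟩
    c            ∎

  G-∨-c : (∀ x y → G (x ∨ y) ≤ G x ∨ F y) → ∀ x → G (x ∨ c) ≡ G x ∨ c
  G-∨-c G-∨ x = antisym G[x∨c]≤Gx∨c (∨-least (G-mono (x≤x∨y x c)) c≤G[x∨c])
    where
    G[x∨c]≤Gx∨c : G (x ∨ c) ≤ G x ∨ c
    G[x∨c]≤Gx∨c = subst (λ z → G (x ∨ c) ≤ G x ∨ z) F-c (G-∨ x c)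

    c≤G[x∨c] : c ≤ G (x ∨ c)
    c≤G[x∨c] = subst (_≤ G (x ∨ c)) G-c (G-mono (y≤x∨y x c))

  F-∧-c : (∀ x y → G (x ∨ y) ≤ G x ∨ F y) → ∀ x → F (x ∧ c) ≡ F x ∧ c
  F-∧-c G-∨ x = begin
    ∼ (G (∼ (x ∧ c)))   ≡⟨ cong (λ z → ∼ (G z)) (∼-∧ x c) ⟩
    ∼ (G (∼ x ∨ ∼ c))   ≡⟨ cong (λ z → ∼ (G (∼ x ∨ z))) ∼c ⟩
    ∼ (G (∼ x ∨ c))     ≡⟨ cong ∼ (G-∨-c G-∨ (∼ x)) ⟩
    ∼ (G (∼ x) ∨ c)     ≡⟨ ∼-∨ (G (∼ x)) c ⟩
    F x ∧ ∼ c           ≡⟨ cong (F x ∧_) ∼c ⟩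
    F x ∧ c             ∎

mainTheorem7 : ∀ {a : Level} (T : TenseDRLAlgebra a) →
    let open TenseDRLAlgebra T in
    ((F c ≡ c) × (P c ≡ c))
    × (∀ x → (G (x ∨ c) ≡ G x ∨ c) × (H (x ∨ c) ≡ H x ∨ c))
    × (∀ x → (F (x ∧ c) ≡ F x ∧ c) × (P (x ∧ c) ≡ P x ∧ c))
mainTheorem7 T =
  (Future.F-c , Past.F-c)
  , (λ x → Future.G-∨-c G-∨ x , Past.G-∨-c H-∨ x)
  , (λ x → Future.F-∧-c G-∨ x , Past.F-∧-c H-∨ x)
  where
  open TenseDRLAlgebra T
  module Future = ConstantPreservingOperator isLattice ∼ ∼-∨ ∼-∧ ∼c G t2-G t1-G
  module Past   = ConstantPreservingOperator isLattice ∼ ∼-∨ ∼-∧ ∼c H t2-H t1-H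

  -- The library order reads x ≤ y as x ≡ x ∧ y, the symmetric form of Defs'.
  G-∨ : ∀ x y → G (x ∨ y) ≡ G (x ∨ y) ∧ (G x ∨ F y)
  G-∨ x y = sym (t4-G x y)

  H-∨ : ∀ x y → H (x ∨ y) ≡ H (x ∨ y) ∧ (H x ∨ P y)
  H-∨ x y = sym (t4-H x y)
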